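{- Let $k\ge 2$ and let $n_1\ge n_2\ge\dots\ge n_k$ be positive integers, and let $N=\sum_{i=1}^k n_i$. If $G$ is a graph such that $K_{n_1,n_2,\dots,n_k}$ is a subgraph of $G$ and $G$ is a subgraph of $L_{n_1}\vee L_{n_2}\vee K_{n_3}\vee K_{n_4}\vee\dots\vee K_{n_k}$, then $$S(G)=2N-n_1-n_2-1.$$
   Context: For a finite simple graph $G=(V,E)$ and an injective map $f:V\to\mathbb Z$, let $\sigma(G,f)=\{f(v)+f(w): vw\in E\}$. The sum index of $G$ is $S(G)=\min_{f}|\sigma(G,f)|$ over all injective $f:V\to\mathbb Z$. $K_{n_1,\dots,n_k}$ is the complete $k$-partite graph with $n_i$ vertices in the $i$-th part. For a positive integer $n$, $L_n$ is the graph with vertex set $\{v_1,\dots,v_n\}$ and edge set $\{v_iv_j: i,j\in[1,n],\ i\ne j,\ i+j\ge n+2\}$. $K_m$ is the complete graph on $m$ vertices. The join $G_1\vee G_2$ of graphs on disjoint vertex sets is obtained from their disjoint union by adding all edges between $G_1$ and $G_2$. The $K_{n_1,\dots,n_k}$ is viewed as a subgraph of the join with its $i$-th part being the vertex set of the $i$-th factor. -}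

module Defs where

open import Data.Nat using (ℕ; _+_; _≤_; _≥_)
open import Data.Integer using (ℤ) renaming (_+_ to _+ℤ_)
open import Data.Fin using (Fin; toℕ)
open import Data.Product using (Σ; ∃; ∃-syntax; _×_)
open import Data.Sum using (_⊎_)
open import Data.List using (List; length; map; allFin)
open import Data.Nat.ListAction using (sum)
open import Data.List.Membership.Propositional using (_∈_)
open import Data.List.Relation.Unary.Unique.Propositional using (Unique)
open import Relation.Binary.PropositionalEquality using (_≡_; _≢_)
open import Relation.Nullary using (¬_)
open import Function.Bundles using (_⇔_)
open import Function.Definitions using (Injective)

record Graph (V : Set) : Set₁ where
  field
    Adj    : V → V → Set
    sym    : ∀ {u v} → Adj u v → Adj v u
    irrefl : ∀ {u} → ¬ Adj u u
open Graph public

_⊆ᴳ_ : {V : Set} → Graph V → Graph V → Set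
H ⊆ᴳ G = ∀ {u v} → Adj H u v → Adj G u v

HasCard : (ℤ → Set) → ℕ → Set
HasCard P m = Σ (List ℤ) λ xs → Unique xs × length xs ≡ m × (∀ z → (z ∈ xs) ⇔ P z)

σ : {V : Set} → Graph V → (V → ℤ) → ℤ → Set
σ G f z = ∃[ u ] ∃[ v ] (Adj G u v × (f u +ℤ f v ≡ z))

SumIndexIs : {V : Set} → Graph V → ℕ → Set
SumIndexIs {V} G m =
  (Σ (V → ℤ) λ f → Injective _≡_ _≡_ f × HasCard (σ G f) m)
  × (∀ (f : V → ℤ) → Injective _≡_ _≡_ f → ∀ m' → HasCard (σ G f) m' → m ≤ m')

-- Vertex set of the k-partite structure: vertex (i , a) is the (a+1)-th vertex
-- of the i-th part (both 0-indexed).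
Vert : (k : ℕ) → (Fin k → ℕ) → Set
Vert k n = Σ (Fin k) λ i → Fin (n i)

KEdge : (k : ℕ) (n : Fin k → ℕ) → Vert k n → Vert k n → Set
KEdge k n (i Data.Product., a) (j Data.Product., b) = i ≢ j

-- Within part i (0-indexed): if i ∈ {0,1} it is L_{n i}: v_{a+1} v_{b+1} with
-- a ≠ b and (a+1)+(b+1) ≥ n i + 2, i.e. a + b ≥ n i; otherwise it is complete.
JoinEdge : (k : ℕ) (n : Fin k → ℕ) → Vert k n → Vert k n → Set
JoinEdge k n (i Data.Product., a) (j Data.Product., b) =
  i ≢ j ⊎ (i ≡ j × toℕ a ≢ toℕ b × (2 ≤ toℕ i ⊎ toℕ a + toℕ b ≥ n i))

total : (k : ℕ) → (Fin k → ℕ) → ℕ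
total k n = sum (map n (allFin k))

{-# OPTIONS --safe #-}
module Submission where

-- Let m minimise an injective labelling f and let b maximise f over
-- the vertices outside the part of m.  The sums f m + f x, for x outside the part
-- of m, are distinct and at most f m + f b; the sums f b + f y, for y outside the
-- part of b with f y > f m, are distinct and exceed f b + f m.  All of them are edge
-- sums of K_{n₁,…,n_k}, so there are at least 2N - n_c - n_q - 1 ≥ 2N - n₁ - n₂ - 1
-- of them, where c ≠ q are the parts of m and b.
--
-- Label the first part 0, …, n₁ - 1, the parts of sizes n₃, …, n_k by
-- the next consecutive integers, and the second part by N - 1, N - 2, …, N - n₂.
-- An edge not inside the first part has an endpoint labelled at least n₁, an edge
-- not inside the second part has an endpoint labelled below N - n₂, and inside
-- these two parts the conditions defining L_{n₁} and L_{n₂} give the same bounds.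
-- So every edge sum lies in [n₁, 2N - n₂ - 2], which has exactly 2N - n₁ - n₂ - 1
-- elements, and the lower bound forces the edge sums to fill it.

open import Defs
open import Data.Nat using (ℕ; _+_; _≤_; _*_; _∸_)
open import Data.Fin using (Fin; toℕ; zero; suc)

open import Data.Nat using (suc; _<_; z≤n; s≤s)
import Data.Nat.Properties as ℕ
open import Algebra.Properties.CommutativeSemigroup ℕ.+-commutativeSemigroup
  using () renaming (interchange to +-interchange)
open import Data.Nat.Tactic.RingSolver using (solve-∀)
open import Data.Nat.ListAction using (sum)
open import Data.Integer using (ℤ; +_)
  renaming (_+_ to _+ℤ_; _≤_ to _≤ℤ_; _<_ to _<ℤ_; _<?_ to _<ℤ?_)
import Data.Integer.Properties as ℤ
open import Algebra.Properties.AbelianGroup ℤ.+-0-abelianGroup using (∙-cancelˡ)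
open import Data.Fin using (fromℕ<)
import Data.Fin.Properties as Fin
open import Data.Product using (∃; _×_; _,_; proj₁; proj₂)
import Data.Product.Properties as Product
open import Data.Sum using (inj₁; inj₂)
open import Data.List using (List; []; _∷_; length; map; filter; _++_; allFin; applyUpTo)
import Data.List.Properties as List
open import Data.List.Membership.Propositional using (_∈_)
open import Data.List.Membership.Propositional.Properties
  using (∈-map⁺; ∈-map⁻; ∈-++⁺ˡ; ∈-++⁺ʳ; ∈-++⁻; ∈-allFin; ∈-filter⁺; ∈-filter⁻; ∈-applyUpTo⁺)
import Data.List.Membership.DecPropositional as DecMembership
open import Data.List.Relation.Binary.Subset.Propositional using (_⊆_)
open import Data.List.Relation.Unary.Any as Any using (here; there)
open import Data.List.Relation.Unary.All as All using (All)
open import Data.List.Relation.Unary.All.Properties using (¬Any⇒All¬; all-filter)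
open import Data.List.Relation.Unary.AllPairs using ([]; _∷_)
open import Data.List.Relation.Unary.Unique.Propositional using (Unique)
import Data.List.Relation.Unary.Unique.Propositional.Properties as Unique
import Data.List.Extrema ℤ.≤-totalOrder as Extrema
open import Data.Empty using (⊥; ⊥-elim)
open import Function using (_∘_)
open import Function.Bundles using (Equivalence; mk⇔)
open import Function.Definitions using (Injective)
open import Relation.Binary.Definitions using (DecidableEquality)
open import Relation.Binary.PropositionalEquality as ≡ using (_≡_; _≢_; refl)
open import Relation.Nullary using (Dec; yes; no; contradiction)
open import Relation.Nullary.Decidable using (¬?)

module _ {A : Set} (_≟_ : DecidableEquality A) where

  open DecMembership _≟_ using (_∈?_)

  Unique-⊆⇒length≤ : ∀ {xs ys : List A} → Unique xs → xs ⊆ ys → length xs ≤ length ys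
  Unique-⊆⇒length≤ {[]} _ _ = z≤n
  Unique-⊆⇒length≤ {x ∷ xs} {ys} (x∉xs ∷ xs!) xs⊆ys =
    ℕ.≤-trans (s≤s (Unique-⊆⇒length≤ xs! xs⊆ys-x))
              (List.filter-notAll x≢? ys (Any.map (λ x≡y x≢y → x≢y x≡y) (xs⊆ys (here refl))))
    where
    x≢? = λ y → ¬? (x ≟ y)
    xs⊆ys-x : xs ⊆ filter x≢? ys
    xs⊆ys-x y∈xs = ∈-filter⁺ x≢? (xs⊆ys (there y∈xs)) (All.lookup x∉xs y∈xs)

  Unique-⊆-length≤⇒⊇ : ∀ {xs ys : List A} → Unique xs → xs ⊆ ys → length ys ≤ length xs → ys ⊆ xs
  Unique-⊆-length≤⇒⊇ {xs} {ys} xs! xs⊆ys ys≤xs {y} y∈ys with y ∈? xs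
  ... | yes y∈xs = y∈xs
  ... | no  y∉xs = contradiction ys≤xs (ℕ.<⇒≱ (Unique-⊆⇒length≤ (¬Any⇒All¬ xs y∉xs ∷ xs!) y∷xs⊆ys))
    where
    y∷xs⊆ys : y ∷ xs ⊆ ys
    y∷xs⊆ys (here refl) = y∈ys
    y∷xs⊆ys (there z∈xs) = xs⊆ys z∈xs

module _ {P : ℤ → Set} {xs : List ℤ} (xs! : Unique xs) (xs⊆P : ∀ {z} → z ∈ xs → P z) where

  HasCard⇒length≤ : ∀ {m} → HasCard P m → length xs ≤ m
  HasCard⇒length≤ (ys , _ , refl , ys⇔P) =
    Unique-⊆⇒length≤ ℤ._≟_ xs! (λ z∈xs → Equivalence.from (ys⇔P _) (xs⊆P z∈xs))

  HasCard-squeeze : ∀ {ys m} → Unique ys → length ys ≡ m → (∀ {z} → P z → z ∈ ys) →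
                    m ≤ length xs → HasCard P m
  HasCard-squeeze {ys} ys! refl P⊆ys m≤xs = ys , ys! , refl , λ z →
    mk⇔ (xs⊆P ∘ Unique-⊆-length≤⇒⊇ ℤ._≟_ xs! (P⊆ys ∘ xs⊆P) m≤xs) P⊆ys

σ-mono : ∀ {V} {H G : Graph V} → H ⊆ᴳ G → ∀ {f z} → σ H f z → σ G f z
σ-mono H⊆G (u , v , uv , fu+fv≡z) = u , v , H⊆G uv , fu+fv≡z

module _ {V : Set} (_≟_ : DecidableEquality V) (G : Graph V)
         {f : V → ℤ} (f-injective : Injective _≡_ _≡_ f) where

  σ-lowerBound : ∀ {m b} {xs ys : List V} →
    (∀ v → f m ≤ℤ f v) → All (λ x → f x ≤ℤ f b) xs →
    All (Adj G m) xs → All (Adj G b) ys → Unique xs → Unique ys →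
    ∃ λ L → Unique L × (∀ {z} → z ∈ L → σ G f z) × length xs + length ys ≤ suc (length L)
  σ-lowerBound {m} {b} {xs} {ys} m-min xs≤b m~xs b~ys xs! ys! =
    low ++ high , Unique.++⁺ low! high! (λ (p , q) → ℤ.<-irrefl refl (low<high p q)) ,
    L⊆σ , length-bound
    where
    above? = λ y → f m <ℤ? f y
    ys⁺ : List V
    ys⁺ = filter above? ys
    low high : List ℤ
    low  = map (λ x → f m +ℤ f x) xs
    high = map (λ y → f b +ℤ f y) ys⁺

    low! : Unique low
    low! = Unique.map⁺ (f-injective ∘ ∙-cancelˡ (f m) _ _) xs!
    high! : Unique high
    high! = Unique.map⁺ (f-injective ∘ ∙-cancelˡ (f b) _ _) (Unique.filter⁺ above? ys!)

    low<high : ∀ {z z′} → z ∈ low → z′ ∈ high → z <ℤ z′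
    low<high p q with ∈-map⁻ _ p | ∈-map⁻ _ q
    ... | x , x∈xs , refl | y , y∈ys⁺ , refl = ℤ.≤-<-trans
      (ℤ.≤-trans (ℤ.+-monoʳ-≤ (f m) (All.lookup xs≤b x∈xs)) (ℤ.≤-reflexive (ℤ.+-comm (f m) (f b))))
      (ℤ.+-monoʳ-< (f b) (proj₂ (∈-filter⁻ above? {xs = ys} y∈ys⁺)))

    L⊆σ : ∀ {z} → z ∈ low ++ high → σ G f z
    L⊆σ p with ∈-++⁻ low p
    ... | inj₁ p-low  with x , x∈xs , refl ← ∈-map⁻ _ p-low  = m , x , All.lookup m~xs x∈xs , refl
    ... | inj₂ p-high with y , y∈ys⁺ , refl ← ∈-map⁻ _ p-high =
      b , y , All.lookup b~ys (proj₁ (∈-filter⁻ above? {xs = ys} y∈ys⁺)) , refl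

    ys⊆m∷ys⁺ : ys ⊆ m ∷ ys⁺
    ys⊆m∷ys⁺ {y} y∈ys with f m <ℤ? f y
    ... | yes fm<fy = there (∈-filter⁺ above? y∈ys fm<fy)
    ... | no  fm≮fy = here (≡.sym (f-injective (ℤ.≤∧≮⇒≡ (m-min y) fm≮fy)))

    length-bound : length xs + length ys ≤ suc (length (low ++ high))
    length-bound = begin
      length xs + length ys        ≤⟨ ℕ.+-monoʳ-≤ (length xs) (Unique-⊆⇒length≤ _≟_ ys! ys⊆m∷ys⁺) ⟩
      length xs + suc (length ys⁺) ≡⟨ ℕ.+-suc (length xs) _ ⟩
      suc (length xs + length ys⁺) ≡⟨ ≡.cong suc (≡.sym length-low++high) ⟩
      suc (length (low ++ high))   ∎
      where
      open ℕ.≤-Reasoning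
      length-low++high : length (low ++ high) ≡ length xs + length ys⁺
      length-low++high = ≡.trans (List.length-++ low)
        (≡.cong₂ _+_ (List.length-map _ xs) (List.length-map _ ys⁺))

total-suc : ∀ K (n : Fin (suc K) → ℕ) → total (suc K) n ≡ n zero + total K (n ∘ suc)
total-suc K n = ≡.cong (λ ns → n zero + sum ns)
  (≡.trans (List.map-tabulate suc n) (≡.sym (List.map-tabulate (λ i → i) (n ∘ suc))))

module _ {K : ℕ} {n : Fin K → ℕ} where

  _≟ᵥ_ : DecidableEquality (Vert K n)
  _≟ᵥ_ = Product.≡-dec Fin._≟_ Fin._≟_

  KEdge? : ∀ u v → Dec (KEdge K n u v)
  KEdge? u v = ¬? (proj₁ u Fin.≟ proj₁ v)

completeMultipartite : ∀ K n → Graph (Vert K n)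
completeMultipartite K n = record
  { Adj    = KEdge K n
  ; sym    = λ i≢j j≡i → i≢j (≡.sym j≡i)
  ; irrefl = λ i≢i → i≢i refl
  }

module FirstPart (K : ℕ) (n : Fin (suc K) → ℕ) where

  firstPart : List (Vert (suc K) n)
  firstPart = map (zero ,_) (allFin (n zero))

  shiftPart : Vert K (n ∘ suc) → Vert (suc K) n
  shiftPart (i , s) = suc i , s

  shiftPart-injective : ∀ {u v} → shiftPart u ≡ shiftPart v → u ≡ v
  shiftPart-injective {_ , _} {_ , _} refl = refl

vertices : ∀ K n → List (Vert K n)
vertices 0       n = []
vertices (suc K) n = firstPart ++ map shiftPart (vertices K (n ∘ suc))
  where open FirstPart K n

∈-vertices : ∀ K n (v : Vert K n) → v ∈ vertices K n
∈-vertices (suc K) n (zero  , s) = ∈-++⁺ˡ (∈-map⁺ (zero ,_) (∈-allFin s))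
  where open FirstPart K n
∈-vertices (suc K) n (suc i , s) =
  ∈-++⁺ʳ firstPart (∈-map⁺ shiftPart (∈-vertices K (n ∘ suc) (i , s)))
  where open FirstPart K n

vertices-unique : ∀ K n → Unique (vertices K n)
vertices-unique 0       n = []
vertices-unique (suc K) n = Unique.++⁺
  (Unique.map⁺ (λ { refl → refl }) (Unique.allFin⁺ (n zero)))
  (Unique.map⁺ shiftPart-injective (vertices-unique K (n ∘ suc)))
  (λ (p , q) → firstPart∩shiftPart (∈-map⁻ _ p) (∈-map⁻ shiftPart q))
  where
  open FirstPart K n
  firstPart∩shiftPart : ∀ {v} → ∃ (λ s → s ∈ allFin (n zero) × v ≡ (zero , s)) →
                        ∃ (λ u → u ∈ vertices K (n ∘ suc) × v ≡ shiftPart u) → ⊥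
  firstPart∩shiftPart (_ , _ , refl) ((_ , _) , _ , ())

length-vertices : ∀ K n → length (vertices K n) ≡ total K n
length-vertices 0       n = refl
length-vertices (suc K) n = begin
  length (firstPart ++ map shiftPart (vertices K (n ∘ suc)))
    ≡⟨ List.length-++ firstPart ⟩
  length firstPart + length (map shiftPart (vertices K (n ∘ suc)))
    ≡⟨ ≡.cong₂ _+_ (≡.trans (List.length-map _ (allFin (n zero))) (List.length-tabulate (λ s → s)))
                   (≡.trans (List.length-map _ (vertices K (n ∘ suc))) (length-vertices K (n ∘ suc))) ⟩
  n zero + total K (n ∘ suc)
    ≡⟨ ≡.sym (total-suc K n) ⟩
  total (suc K) n ∎
  where
  open FirstPart K n
  open ≡.≡-Reasoning

module _ {K : ℕ} {n : Fin K → ℕ} where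

  neighbours : Vert K n → List (Vert K n)
  neighbours u = filter (KEdge? u) (vertices K n)

  neighbours-unique : ∀ u → Unique (neighbours u)
  neighbours-unique u = Unique.filter⁺ (KEdge? u) (vertices-unique K n)

  neighbours-adjacent : ∀ u → All (KEdge K n u) (neighbours u)
  neighbours-adjacent u = all-filter (KEdge? u) (vertices K n)

  length-neighbours : ∀ u → total K n ≤ length (neighbours u) + n (proj₁ u)
  length-neighbours u@(c , _) = begin
    total K n                           ≡⟨ ≡.sym (length-vertices K n) ⟩
    length (vertices K n)               ≤⟨ Unique-⊆⇒length≤ _≟ᵥ_ (vertices-unique K n) vertices⊆ ⟩
    length (neighbours u ++ part)       ≡⟨ List.length-++ (neighbours u) ⟩
    length (neighbours u) + length part ≡⟨ ≡.cong (λ l → length (neighbours u) + l) length-part ⟩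
    length (neighbours u) + n c         ∎
    where
    open ℕ.≤-Reasoning
    part : List (Vert K n)
    part = map (c ,_) (allFin (n c))
    length-part : length part ≡ n c
    length-part = ≡.trans (List.length-map _ (allFin (n c))) (List.length-tabulate (λ s → s))
    vertices⊆ : vertices K n ⊆ neighbours u ++ part
    vertices⊆ {i , s} _ with c Fin.≟ i
    ... | yes refl = ∈-++⁺ʳ (neighbours u) (∈-map⁺ (c ,_) (∈-allFin s))
    ... | no  c≢i  = ∈-++⁺ˡ (∈-filter⁺ (KEdge? u) (∈-vertices K n (i , s)) c≢i)

double-count : ∀ {N x y c d l M} → N ≤ x + c → N ≤ y + d → x + y ≤ suc l → c + d ≤ M →
               2 * N ≤ suc l + M
double-count {N} {x} {y} {c} {d} {l} {M} N≤x+c N≤y+d x+y≤1+l c+d≤M = begin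
  2 * N                 ≡⟨ ≡.cong (λ M → N + M) (ℕ.+-identityʳ N) ⟩
  N + N                 ≤⟨ ℕ.+-mono-≤ N≤x+c N≤y+d ⟩
  (x + c) + (y + d)     ≡⟨ +-interchange x c y d ⟩
  (x + y) + (c + d)     ≤⟨ ℕ.+-mono-≤ x+y≤1+l c+d≤M ⟩
  suc l + M             ∎
  where open ℕ.≤-Reasoning

completeMultipartite-σ-lowerBound : ∀ {K n M} {f : Vert K n → ℤ} → Injective _≡_ _≡_ f →
  Vert K n → (∀ u → ∃ (KEdge K n u)) → (∀ c q → c ≢ q → n c + n q ≤ M) →
  ∃ λ L → Unique L × (∀ {z} → z ∈ L → σ (completeMultipartite K n) f z) ×
          2 * total K n ≤ suc (length L) + M
completeMultipartite-σ-lowerBound {K} {n} {M} {f} f-injective v₀ has-neighbour parts≤M =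
  let L , L! , L⊆σ , length-L = σ-lowerBound _≟ᵥ_ (completeMultipartite K n) f-injective m-min b-max
        (neighbours-adjacent m) (neighbours-adjacent b) (neighbours-unique m) (neighbours-unique b)
  in  L , L! , L⊆σ ,
      double-count {x = length (neighbours m)} {y = length (neighbours b)}
                   {c = n (proj₁ m)} {d = n (proj₁ b)}
        (length-neighbours m) (length-neighbours b) length-L (parts≤M _ _ m~b)
  where
  m : Vert K n
  m = Extrema.argmin f v₀ (vertices K n)
  m-min : ∀ v → f m ≤ℤ f v
  m-min v = All.lookup (Extrema.f[argmin]≤f[xs] {f = f} v₀ (vertices K n)) (∈-vertices K n v)
  w₀ : Vert K n
  w₀ = proj₁ (has-neighbour m)
  b : Vert K n
  b = Extrema.argmax f w₀ (neighbours m)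
  b-max : All (λ x → f x ≤ℤ f b) (neighbours m)
  b-max = Extrema.f[xs]≤f[argmax] {f = f} w₀ (neighbours m)
  m~b : KEdge K n m b
  m~b = Extrema.argmax-all f (proj₂ (has-neighbour m)) (neighbours-adjacent m)

blockIndex : ∀ {K n} → Vert K n → ℕ
blockIndex {suc K} {n} (zero  , s) = toℕ s
blockIndex {suc K} {n} (suc i , s) = n zero + blockIndex {K} {n ∘ suc} (i , s)

blockIndex<total : ∀ {K n} (v : Vert K n) → blockIndex v < total K n
blockIndex<total {suc K} {n} (zero , s) = ≡.subst (toℕ s <_) (≡.sym (total-suc K n))
  (ℕ.<-≤-trans (Fin.toℕ<n s) (ℕ.m≤m+n (n zero) _))
blockIndex<total {suc K} {n} (suc i , s) = ≡.subst (blockIndex {suc K} {n} (suc i , s) <_)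
  (≡.sym (total-suc K n)) (ℕ.+-monoʳ-< (n zero) (blockIndex<total {K} {n ∘ suc} (i , s)))

blockIndex-injective : ∀ {K n} → Injective _≡_ _≡_ (blockIndex {K} {n})
blockIndex-injective {suc K} {n} {zero , s} {zero , t} eq = ≡.cong (zero ,_) (Fin.toℕ-injective eq)
blockIndex-injective {suc K} {n} {zero , s} {suc j , t} eq =
  ⊥-elim (ℕ.<⇒≢ (ℕ.<-≤-trans (Fin.toℕ<n s) (ℕ.m≤m+n (n zero) _)) eq)
blockIndex-injective {suc K} {n} {suc i , s} {zero , t} eq =
  ⊥-elim (ℕ.<⇒≢ (ℕ.<-≤-trans (Fin.toℕ<n t) (ℕ.m≤m+n (n zero) _)) (≡.sym eq))
blockIndex-injective {suc K} {n} {suc i , s} {suc j , t} eq =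
  ≡.cong shiftPart (blockIndex-injective {K} {n ∘ suc} (ℕ.+-cancelˡ-≡ (n zero) _ _ eq))
  where open FirstPart K n

m∸n∸o∸1≡m∸[n+[o+1]] : ∀ m n o → m ∸ n ∸ o ∸ 1 ≡ m ∸ (n + (o + 1))
m∸n∸o∸1≡m∸[n+[o+1]] m n o = ≡.trans (ℕ.∸-+-assoc (m ∸ n) o 1) (ℕ.∸-+-assoc m n (o + 1))

m≤1+n+[o+p]⇒m∸o∸p∸1≤n : ∀ {m n} o p → m ≤ suc n + (o + p) → m ∸ o ∸ p ∸ 1 ≤ n
m≤1+n+[o+p]⇒m∸o∸p∸1≤n {m} {n} o p m≤ = ≡.subst (_≤ n) (≡.sym (m∸n∸o∸1≡m∸[n+[o+1]] m o p))
  (ℕ.m≤n+o⇒m∸n≤o m (o + (p + 1)) (≡.subst (m ≤_) (rearrange n o p) m≤))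
  where
  rearrange : ∀ n o p → suc n + (o + p) ≡ o + (p + 1) + n
  rearrange = solve-∀

n≤m⇒m+p+2≤o⇒m∸n<o∸n∸p∸1 : ∀ {m o} n p → n ≤ m → m + p + 2 ≤ o → m ∸ n < o ∸ n ∸ p ∸ 1
n≤m⇒m+p+2≤o⇒m∸n<o∸n∸p∸1 {m} {o} n p n≤m m+p+2≤o =
  ≡.subst (m ∸ n <_) (≡.sym (m∸n∸o∸1≡m∸[n+[o+1]] o n p))
  (ℕ.m+n≤o⇒m≤o∸n (suc (m ∸ n)) (≡.subst (_≤ o) (≡.sym eq) m+p+2≤o))
  where
  rearrange : ∀ d n p → suc d + (n + (p + 1)) ≡ d + n + p + 2
  rearrange = solve-∀
  eq : suc (m ∸ n) + (n + (p + 1)) ≡ m + p + 2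
  eq = ≡.trans (rearrange (m ∸ n) n p) (≡.cong (λ x → x + p + 2) (ℕ.m∸n+n≡m n≤m))

interval : ℕ → ℕ → List ℤ
interval a B = applyUpTo (λ t → + (a + t)) B

interval-unique : ∀ a B → Unique (interval a B)
interval-unique a B = Unique.applyUpTo⁺₁ _ B
  (λ i<j _ eq → ℕ.<⇒≢ i<j (ℕ.+-cancelˡ-≡ a _ _ (ℤ.+-injective eq)))

length-interval : ∀ a B → length (interval a B) ≡ B
length-interval a B = List.length-applyUpTo _ B

∈-interval : ∀ {a B x} → a ≤ x → x ∸ a < B → + x ∈ interval a B
∈-interval {a} {B} {x} a≤x x∸a<B =
  ≡.subst (λ y → + y ∈ interval a B) (ℕ.m+[n∸m]≡n a≤x) (∈-applyUpTo⁺ (λ t → + (a + t)) x∸a<B)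

module Labelling (k : ℕ) (n : Fin (2 + k) → ℕ) where

  rest : Fin k → ℕ
  rest j = n (suc (suc j))

  N a b r B : ℕ
  N = total (2 + k) n
  a = n zero
  b = n (suc zero)
  r = total k rest
  B = 2 * N ∸ a ∸ b ∸ 1

  N≡a+r+b : N ≡ a + r + b
  N≡a+r+b = begin
    N                           ≡⟨ total-suc (suc k) n ⟩
    a + total (suc k) (n ∘ suc) ≡⟨ ≡.cong (λ t → a + t) (total-suc k (n ∘ suc)) ⟩
    a + (b + r)                 ≡⟨ rearrange a b r ⟩
    a + r + b                   ∎
    where
    open ≡.≡-Reasoning
    rearrange : ∀ a b r → a + (b + r) ≡ a + r + b
    rearrange = solve-∀

  ℓ : Vert (2 + k) n → ℕ
  ℓ (zero        , s) = toℕ s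
  ℓ (suc zero    , s) = N ∸ suc (toℕ s)
  ℓ (suc (suc j) , s) = a + blockIndex {k} {rest} (j , s)

  ℓ₁+1+s≡N : ∀ s → ℓ (suc zero , s) + suc (toℕ s) ≡ N
  ℓ₁+1+s≡N s = ℕ.m∸n+n≡m (ℕ.≤-trans (Fin.toℕ<n s) (≡.subst (b ≤_) (≡.sym N≡a+r+b) (ℕ.m≤n+m b _)))

  a+r≤ℓ₁ : ∀ s → a + r ≤ ℓ (suc zero , s)
  a+r≤ℓ₁ s = ℕ.+-cancelʳ-≤ (suc (toℕ s)) (a + r) _ (begin
    a + r + suc (toℕ s)               ≤⟨ ℕ.+-monoʳ-≤ (a + r) (Fin.toℕ<n s) ⟩
    a + r + b                         ≡⟨ ≡.sym N≡a+r+b ⟩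
    N                                 ≡⟨ ≡.sym (ℓ₁+1+s≡N s) ⟩
    ℓ (suc zero , s) + suc (toℕ s)    ∎)
    where open ℕ.≤-Reasoning

  ℓ<a : ∀ s → ℓ (zero , s) < a
  ℓ<a = Fin.toℕ<n

  a≤ℓ : ∀ v → proj₁ v ≢ zero → a ≤ ℓ v
  a≤ℓ (zero        , _) 0≢0 = ⊥-elim (0≢0 refl)
  a≤ℓ (suc zero    , s) _   = ℕ.≤-trans (ℕ.m≤m+n a r) (a+r≤ℓ₁ s)
  a≤ℓ (suc (suc _) , _) _   = ℕ.m≤m+n a _

  ℓ<a+r : ∀ v → proj₁ v ≢ suc zero → ℓ v < a + r
  ℓ<a+r (zero        , s) _   = ℕ.<-≤-trans (ℓ<a s) (ℕ.m≤m+n a r)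
  ℓ<a+r (suc zero    , _) 1≢1 = ⊥-elim (1≢1 refl)
  ℓ<a+r (suc (suc j) , s) _   = ℕ.+-monoʳ-< a (blockIndex<total {k} {rest} (j , s))

  a+r≤N : a + r ≤ N
  a+r≤N = ≡.subst (a + r ≤_) (≡.sym N≡a+r+b) (ℕ.m≤m+n (a + r) b)

  ℓ<N : ∀ v → ℓ v < N
  ℓ<N (suc zero , s) = ≡.subst (ℓ (suc zero , s) <_) (ℓ₁+1+s≡N s) (ℕ.m<m+n _ ℕ.0<1+n)
  ℓ<N v@(zero        , _) = ℕ.<-≤-trans (ℓ<a+r v λ ()) a+r≤N
  ℓ<N v@(suc (suc _) , _) = ℕ.<-≤-trans (ℓ<a+r v λ ()) a+r≤N

  ℓ₁-injective : ∀ {s t} → ℓ (suc zero , s) ≡ ℓ (suc zero , t) → s ≡ t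
  ℓ₁-injective {s} {t} eq =
    Fin.toℕ-injective (ℕ.suc-injective (ℕ.+-cancelˡ-≡ (ℓ (suc zero , t)) _ _ (begin
    ℓ (suc zero , t) + suc (toℕ s) ≡⟨ ≡.cong (_+ suc (toℕ s)) (≡.sym eq) ⟩
    ℓ (suc zero , s) + suc (toℕ s) ≡⟨ ℓ₁+1+s≡N s ⟩
    N                              ≡⟨ ≡.sym (ℓ₁+1+s≡N t) ⟩
    ℓ (suc zero , t) + suc (toℕ t) ∎)))
    where open ≡.≡-Reasoning

  inRest : Vert k rest → Vert (2 + k) n
  inRest (j , s) = suc (suc j) , s

  ℓ-injective : Injective _≡_ _≡_ ℓ
  ℓ-injective {zero , _} {zero , _} eq = ≡.cong (zero ,_) (Fin.toℕ-injective eq)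
  ℓ-injective {suc zero , _} {suc zero , _} eq = ≡.cong (suc zero ,_) (ℓ₁-injective eq)
  ℓ-injective {suc (suc _) , _} {suc (suc _) , _} eq =
    ≡.cong inRest (blockIndex-injective {k} {rest} (ℕ.+-cancelˡ-≡ a _ _ eq))
  ℓ-injective {zero , s} {v@(suc _ , _)} eq =
    ⊥-elim (ℕ.<⇒≢ (ℕ.<-≤-trans (ℓ<a s) (a≤ℓ v λ ())) eq)
  ℓ-injective {u@(suc _ , _)} {zero , t} eq =
    ⊥-elim (ℕ.<⇒≢ (ℕ.<-≤-trans (ℓ<a t) (a≤ℓ u λ ())) (≡.sym eq))
  ℓ-injective {suc zero , s} {v@(suc (suc _) , _)} eq =
    ⊥-elim (ℕ.<⇒≢ (ℕ.<-≤-trans (ℓ<a+r v λ ()) (a+r≤ℓ₁ s)) (≡.sym eq))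
  ℓ-injective {u@(suc (suc _) , _)} {suc zero , t} eq =
    ⊥-elim (ℕ.<⇒≢ (ℕ.<-≤-trans (ℓ<a+r u λ ()) (a+r≤ℓ₁ t)) eq)

  a≤ℓ+ℓ : ∀ u v → JoinEdge (2 + k) n u v → a ≤ ℓ u + ℓ v
  a≤ℓ+ℓ (zero , _) (zero , _) (inj₁ 0≢0)                = ⊥-elim (0≢0 refl)
  a≤ℓ+ℓ (zero , _) (zero , _) (inj₂ (_ , _ , inj₁ ()))
  a≤ℓ+ℓ (zero , _) (zero , _) (inj₂ (_ , _ , inj₂ a≤s+t)) = a≤s+t
  a≤ℓ+ℓ (zero , _) v@(suc _ , _) _ = ℕ.≤-trans (a≤ℓ v λ ()) (ℕ.m≤n+m _ _)
  a≤ℓ+ℓ u@(suc _ , _) v          _ = ℕ.≤-trans (a≤ℓ u λ ()) (ℕ.m≤m+n _ _)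

  2*N≡N+N : 2 * N ≡ N + N
  2*N≡N+N = ≡.cong (λ M → N + M) (ℕ.+-identityʳ N)

  ℓ+ℓ+b+2≤2*N-off-part₁ : ∀ u v → proj₁ u ≢ suc zero → ℓ u + ℓ v + b + 2 ≤ 2 * N
  ℓ+ℓ+b+2≤2*N-off-part₁ u v u∉₁ = begin
    ℓ u + ℓ v + b + 2           ≡⟨ rearrange (ℓ u) (ℓ v) b ⟩
    (suc (ℓ u) + b) + suc (ℓ v) ≤⟨ ℕ.+-mono-≤ (ℕ.+-monoˡ-≤ b (ℓ<a+r u u∉₁)) (ℓ<N v) ⟩
    (a + r + b) + N             ≡⟨ ≡.cong (_+ N) (≡.sym N≡a+r+b) ⟩
    N + N                       ≡⟨ ≡.sym 2*N≡N+N ⟩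
    2 * N                       ∎
    where
    open ℕ.≤-Reasoning
    rearrange : ∀ x y b → x + y + b + 2 ≡ (suc x + b) + suc y
    rearrange = solve-∀

  ℓ+ℓ+b+2≤2*N-in-part₁ : ∀ s t → b ≤ toℕ s + toℕ t →
                         ℓ (suc zero , s) + ℓ (suc zero , t) + b + 2 ≤ 2 * N
  ℓ+ℓ+b+2≤2*N-in-part₁ s t b≤s+t = begin
    x + y + b + 2                               ≤⟨ ℕ.+-monoˡ-≤ 2 (ℕ.+-monoʳ-≤ (x + y) b≤s+t) ⟩
    x + y + (toℕ s + toℕ t) + 2                 ≡⟨ rearrange x y (toℕ s) (toℕ t) ⟩
    (x + suc (toℕ s)) + (y + suc (toℕ t))       ≡⟨ ≡.cong₂ _+_ (ℓ₁+1+s≡N s) (ℓ₁+1+s≡N t) ⟩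
    N + N                                       ≡⟨ ≡.sym 2*N≡N+N ⟩
    2 * N                                       ∎
    where
    open ℕ.≤-Reasoning
    x = ℓ (suc zero , s)
    y = ℓ (suc zero , t)
    rearrange : ∀ x y s t → x + y + (s + t) + 2 ≡ (x + suc s) + (y + suc t)
    rearrange = solve-∀

  ℓ+ℓ+b+2≤2*N : ∀ u v → JoinEdge (2 + k) n u v → ℓ u + ℓ v + b + 2 ≤ 2 * N
  ℓ+ℓ+b+2≤2*N (suc zero , _) (suc zero , _) (inj₁ 1≢1)                = ⊥-elim (1≢1 refl)
  ℓ+ℓ+b+2≤2*N (suc zero , _) (suc zero , _) (inj₂ (_ , _ , inj₁ (s≤s ())))
  ℓ+ℓ+b+2≤2*N (suc zero , s) (suc zero , t) (inj₂ (_ , _ , inj₂ b≤s+t)) =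
    ℓ+ℓ+b+2≤2*N-in-part₁ s t b≤s+t
  ℓ+ℓ+b+2≤2*N u@(zero        , _) v _ = ℓ+ℓ+b+2≤2*N-off-part₁ u v λ ()
  ℓ+ℓ+b+2≤2*N u@(suc (suc _) , _) v _ = ℓ+ℓ+b+2≤2*N-off-part₁ u v λ ()
  ℓ+ℓ+b+2≤2*N u@(suc zero , _) v@(zero , _) _ =
    ≡.subst (λ x → x + b + 2 ≤ 2 * N) (ℕ.+-comm (ℓ v) (ℓ u)) (ℓ+ℓ+b+2≤2*N-off-part₁ v u λ ())
  ℓ+ℓ+b+2≤2*N u@(suc zero , _) v@(suc (suc _) , _) _ =
    ≡.subst (λ x → x + b + 2 ≤ 2 * N) (ℕ.+-comm (ℓ v) (ℓ u)) (ℓ+ℓ+b+2≤2*N-off-part₁ v u λ ())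

  ℓℤ : Vert (2 + k) n → ℤ
  ℓℤ v = + ℓ v

  ℓℤ-injective : Injective _≡_ _≡_ ℓℤ
  ℓℤ-injective = ℓ-injective ∘ ℤ.+-injective

  σ⊆interval : ∀ {G : Graph (Vert (2 + k) n)} → (∀ {u v} → Adj G u v → JoinEdge (2 + k) n u v) →
               ∀ {z} → σ G ℓℤ z → z ∈ interval a B
  σ⊆interval G⊆J (u , v , uv , refl) =
    ∈-interval a≤ℓu+ℓv (n≤m⇒m+p+2≤o⇒m∸n<o∸n∸p∸1 a b a≤ℓu+ℓv (ℓ+ℓ+b+2≤2*N u v (G⊆J uv)))
    where a≤ℓu+ℓv = a≤ℓ+ℓ u v (G⊆J uv)

distinct-parts≤first-two : ∀ {k} (n : Fin (2 + k) → ℕ) → (∀ i j → toℕ i ≤ toℕ j → n j ≤ n i) →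
                  ∀ c q → c ≢ q → n c + n q ≤ n zero + n (suc zero)
distinct-parts≤first-two n sorted zero    zero    0≢0 = ⊥-elim (0≢0 refl)
distinct-parts≤first-two n sorted zero    (suc q) _   =
  ℕ.+-monoʳ-≤ (n zero) (sorted (suc zero) (suc q) (s≤s z≤n))
distinct-parts≤first-two n sorted (suc c) q       _   = ℕ.≤-trans
  (ℕ.+-mono-≤ (sorted (suc zero) (suc c) (s≤s z≤n)) (sorted zero q z≤n))
  (ℕ.≤-reflexive (ℕ.+-comm (n (suc zero)) (n zero)))

hasNeighbour : ∀ {k} (n : Fin (2 + k) → ℕ) → (∀ i → 1 ≤ n i) → ∀ u → ∃ (KEdge (2 + k) n u)
hasNeighbour n positive (zero  , _) = (suc zero , fromℕ< (positive (suc zero))) , λ ()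
hasNeighbour n positive (suc _ , _) = (zero , fromℕ< (positive zero)) , λ ()

sorted-σ-lowerBound : ∀ k (n : Fin (2 + k) → ℕ) →
  (∀ i → 1 ≤ n i) → (∀ i j → toℕ i ≤ toℕ j → n j ≤ n i) → ∀ {f} → Injective _≡_ _≡_ f →
  ∃ λ L → Unique L × (∀ {z} → z ∈ L → σ (completeMultipartite (2 + k) n) f z) ×
          2 * total (2 + k) n ∸ n zero ∸ n (suc zero) ∸ 1 ≤ length L
sorted-σ-lowerBound k n positive sorted f-injective =
  let L , L! , L⊆σ , length-L = completeMultipartite-σ-lowerBound f-injective
        (zero , fromℕ< (positive zero)) (hasNeighbour n positive) (distinct-parts≤first-two n sorted)
  in  L , L! , L⊆σ , m≤1+n+[o+p]⇒m∸o∸p∸1≤n (n zero) (n (suc zero)) length-L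

corollary2p3 : (k : ℕ) (n : Fin (2 + k) → ℕ)
    → (∀ i → 1 ≤ n i)
    → (∀ i j → toℕ i ≤ toℕ j → n j ≤ n i)
    → (G : Graph (Vert (2 + k) n))
    → (∀ {u v} → KEdge (2 + k) n u v → Adj G u v)
    → (∀ {u v} → Adj G u v → JoinEdge (2 + k) n u v)
    → SumIndexIs G (2 * total (2 + k) n ∸ n zero ∸ n (suc zero) ∸ 1)
corollary2p3 k n positive sorted G K⊆G G⊆J =
  (ℓℤ , ℓℤ-injective , attained) ,
  λ f f-injective _ card →
    let _ , L! , L⊆σ , B≤L = sorted-σ-lowerBound k n positive sorted {f} f-injective
    in  ℕ.≤-trans B≤L (HasCard⇒length≤ L! (λ z∈L → K-sums⊆G-sums {f} (L⊆σ z∈L)) card)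
  where
  open Labelling k n
  K-sums⊆G-sums : ∀ {f z} → σ (completeMultipartite (2 + k) n) f z → σ G f z
  K-sums⊆G-sums {f} = σ-mono {H = completeMultipartite (2 + k) n} {G} K⊆G {f}
  attained : HasCard (σ G ℓℤ) B
  attained =
    let _ , L! , L⊆σ , B≤L = sorted-σ-lowerBound k n positive sorted {ℓℤ} ℓℤ-injective
    in  HasCard-squeeze L! (λ z∈L → K-sums⊆G-sums {ℓℤ} (L⊆σ z∈L))
          (interval-unique a B) (length-interval a B) (σ⊆interval {G} G⊆J) B≤L
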